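{- $\mathsf{RAsc}\subseteq\mathsf{RGF}\subseteq\mathsf{Asc}$, and both containments are strict.
   Context: $\mathsf{asc}(a_1,\ldots,a_k)$ is the number of $i\in[1,k)$ with $a_i<a_{i+1}$. $\mathsf{Asc}$ is the set of ascent sequences, i.e. finite sequences $(a_1,\ldots,a_n)$ of non-negative integers with $a_1=0$ and $a_i\le\mathsf{asc}(a_1,\ldots,a_{i-1})+1$ for $1<i\le n$. $\mathsf{RAsc}$ is the set of ascent sequences with $a_k\in[0,a_{k-1}]\cup\{1+\mathsf{asc}(a_1,\ldots,a_{k-1})\}$ for all $k>1$. $\mathsf{RGF}$ is the set of restricted growth functions: finite sequences of non-negative integers (nonempty, beginning with $0$) in which each $j>0$ that appears is preceded by an appearance of $j-1$. -}

module Defs where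

open import Data.Nat using (ℕ; zero; suc; _≤_; _<_; _<ᵇ_)
open import Data.Bool using (if_then_else_)
open import Data.List using (List; []; _∷_; _++_; [_])
open import Data.List.Membership.Propositional using (_∈_)
open import Data.Product using (_×_; ∃)
open import Data.Sum using (_⊎_)
open import Relation.Binary.PropositionalEquality using (_≡_)

asc : List ℕ → ℕ
asc []           = 0
asc (x ∷ [])     = 0
asc (x ∷ y ∷ xs) = if x <ᵇ y then suc (asc (y ∷ xs)) else asc (y ∷ xs)

-- The entry x at position i > 1 is written via a decomposition
-- s = pre ++ y ∷ x ∷ post, so that (a₁,…,a_{i-1}) = pre ++ [ y ].
IsAsc : List ℕ → Set
IsAsc s = (∃ λ rest → s ≡ 0 ∷ rest)
        × (∀ pre y x post → s ≡ pre ++ y ∷ x ∷ post →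
             x ≤ suc (asc (pre ++ [ y ])))

IsRAsc : List ℕ → Set
IsRAsc s = IsAsc s
         × (∀ pre y x post → s ≡ pre ++ y ∷ x ∷ post →
              x ≤ y ⊎ x ≡ suc (asc (pre ++ [ y ])))

IsRGF : List ℕ → Set
IsRGF s = (∃ λ rest → s ≡ 0 ∷ rest)
        × (∀ pre j post → s ≡ pre ++ suc j ∷ post → j ∈ pre)

-- Along an ascent sequence the entries of every prefix p stay in [0, asc p]:
-- a new entry either is at most its predecessor, which leaves asc unchanged,
-- or ascends, which raises asc by one.  In a restricted growth function a
-- new entry j + 1 needs j among the earlier entries, so it is at most
-- asc p + 1; hence RGF ⊆ Asc.  In a restricted ascent sequence the prefix
-- values even fill all of [0, asc p], since the only entry exceeding its
-- predecessor is asc p + 1; so j + 1 ≤ asc p + 1 finds j among them and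
-- RAsc ⊆ RGF.  The sequences 0101 ∈ RGF ∖ RAsc and 01013 ∈ Asc ∖ RGF show
-- both inclusions are strict.
module Submission where

open import Defs
open import Data.List using (List)
open import Data.Nat using (ℕ)
open import Data.Product using (_×_; ∃)
open import Relation.Nullary using (¬_)

open import Data.Nat using (zero; suc; _≤_; _<_; _<ᵇ_; _≤?_; z≤n; s≤s)
open import Data.Nat.Properties
  using (≤-refl; ≤-reflexive; ≤-trans; ≤-pred; ≰⇒>; <⇒≱; m≤n⇒m≤1+n; n≤1+n; m≤n⇒m<n∨m≡n; <ᵇ-reflects-<; suc-injective)
open import Data.Bool using (true; false; if_then_else_)
open import Data.List using ([]; _∷_; _++_; [_]; _∷ʳ_)
open import Data.List.Properties using (∷ʳ-++)
open import Data.List.Reverse using (Reverse; []; _∶_∶ʳ_; reverseView)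
open import Data.List.Membership.Propositional using (_∈_)
open import Data.List.Membership.Propositional.Properties using (∈-++⁺ˡ; ∈-++⁺ʳ; ∈-++⁻)
open import Data.List.Relation.Unary.Any using (here; there)
open import Data.Product using (_,_; proj₂)
open import Data.Sum using (_⊎_; inj₁; inj₂)
open import Relation.Nullary using (yes; no; contradiction)
open import Relation.Nullary.Reflects using (ofʸ; ofⁿ)
open import Relation.Binary.PropositionalEquality using (_≡_; refl; sym; trans)
open import Function using (_∘_)

∈-∷ʳ⁻ : ∀ {A : Set} {z x : A} xs → z ∈ xs ∷ʳ x → z ∈ xs ⊎ z ≡ x
∈-∷ʳ⁻ xs z∈ with ∈-++⁻ xs z∈
... | inj₁ z∈xs       = inj₁ z∈xs
... | inj₂ (here z≡x) = inj₂ z≡x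

prefix-induction : ∀ {A : Set} {s : List A} {h} (P : List A → Set) →
                   (∃ λ rest → s ≡ h ∷ rest) → P [ h ] →
                   (∀ q y x post → s ≡ q ++ y ∷ x ∷ post → P (q ∷ʳ y) → P (q ∷ʳ y ∷ʳ x)) →
                   ∀ p y post → s ≡ p ++ y ∷ post → P (p ∷ʳ y)
prefix-induction {s = s} P (_ , s≡h∷rest) base step p = go (reverseView p)
  where
  go : ∀ {p} → Reverse p → ∀ y post → s ≡ p ++ y ∷ post → P (p ∷ʳ y)
  go [] y post s≡y∷post with trans (sym s≡h∷rest) s≡y∷post
  ... | refl = base
  go (q ∶ q′ ∶ʳ y′) y post s≡q∷ʳy′++y∷post =
    step q y′ y post s≡q++y′∷y∷post (go q′ y′ (y ∷ post) s≡q++y′∷y∷post)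
    where
    s≡q++y′∷y∷post : s ≡ q ++ y′ ∷ y ∷ post
    s≡q++y′∷y∷post = trans s≡q∷ʳy′++y∷post (∷ʳ-++ q y′ (y ∷ post))

asc-∷ʳ : ∀ p y x → asc (p ∷ʳ y ∷ʳ x) ≡ (if y <ᵇ x then suc (asc (p ∷ʳ y)) else asc (p ∷ʳ y))
asc-∷ʳ []            y x = refl
asc-∷ʳ (a ∷ [])      y x with a <ᵇ y | y <ᵇ x
... | true  | true  = refl
... | true  | false = refl
... | false | true  = refl
... | false | false = refl
asc-∷ʳ (a ∷ b ∷ p) y x rewrite asc-∷ʳ (b ∷ p) y x with a <ᵇ b | y <ᵇ x
... | true  | true  = refl
... | true  | false = refl
... | false | true  = refl
... | false | false = refl

asc-∷ʳ-≤ : ∀ p {y x} → x ≤ y → asc (p ∷ʳ y ∷ʳ x) ≡ asc (p ∷ʳ y)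
asc-∷ʳ-≤ p {y} {x} x≤y rewrite asc-∷ʳ p y x with y <ᵇ x | <ᵇ-reflects-< y x
... | true  | ofʸ y<x = contradiction x≤y (<⇒≱ y<x)
... | false | _       = refl

asc-∷ʳ-> : ∀ p {y x} → y < x → asc (p ∷ʳ y ∷ʳ x) ≡ suc (asc (p ∷ʳ y))
asc-∷ʳ-> p {y} {x} y<x rewrite asc-∷ʳ p y x with y <ᵇ x | <ᵇ-reflects-< y x
... | true  | _        = refl
... | false | ofⁿ y≮x = contradiction y<x y≮x

Bounded : ℕ → List ℕ → Set
Bounded n p = ∀ {z} → z ∈ p → z ≤ n

Exhausts : ℕ → List ℕ → Set
Exhausts n p = ∀ {k} → k ≤ n → k ∈ p

bounded-[0] : Bounded 0 [ 0 ]
bounded-[0] (here refl) = z≤n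

exhausts-[0] : Exhausts 0 [ 0 ]
exhausts-[0] z≤n = here refl

bounded-∷ʳ : ∀ p {y x} → Bounded (asc (p ∷ʳ y)) (p ∷ʳ y) → x ≤ suc (asc (p ∷ʳ y)) →
             Bounded (asc (p ∷ʳ y ∷ʳ x)) (p ∷ʳ y ∷ʳ x)
bounded-∷ʳ p {y} {x} bounded x≤asc+1 {z} z∈ with x ≤? y | ∈-∷ʳ⁻ (p ∷ʳ y) z∈
... | yes x≤y | inj₁ z∈p∷ʳy rewrite asc-∷ʳ-≤ p x≤y = bounded z∈p∷ʳy
... | yes x≤y | inj₂ refl   rewrite asc-∷ʳ-≤ p x≤y = ≤-trans x≤y (bounded (∈-++⁺ʳ p (here refl)))
... | no  x≰y | inj₁ z∈p∷ʳy rewrite asc-∷ʳ-> p (≰⇒> x≰y) = m≤n⇒m≤1+n (bounded z∈p∷ʳy)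
... | no  x≰y | inj₂ refl   rewrite asc-∷ʳ-> p (≰⇒> x≰y) = x≤asc+1

exhausts-∷ʳ : ∀ p {y x} → Bounded (asc (p ∷ʳ y)) (p ∷ʳ y) → Exhausts (asc (p ∷ʳ y)) (p ∷ʳ y) →
              x ≤ y ⊎ x ≡ suc (asc (p ∷ʳ y)) → Exhausts (asc (p ∷ʳ y ∷ʳ x)) (p ∷ʳ y ∷ʳ x)
exhausts-∷ʳ p _ exhausts (inj₁ x≤y) rewrite asc-∷ʳ-≤ p x≤y = ∈-++⁺ˡ ∘ exhausts
exhausts-∷ʳ p {y} bounded exhausts (inj₂ refl) {k} k≤asc
  rewrite asc-∷ʳ-> p {y} (s≤s (bounded (∈-++⁺ʳ p (here refl))))
  with m≤n⇒m<n∨m≡n k≤asc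
... | inj₁ k<asc = ∈-++⁺ˡ (exhausts (≤-pred k<asc))
... | inj₂ refl  = ∈-++⁺ʳ (p ∷ʳ y) (here refl)

bounded-prefixes : ∀ {s} → (∃ λ rest → s ≡ 0 ∷ rest) →
                   (∀ q y x post → s ≡ q ++ y ∷ x ∷ post →
                      Bounded (asc (q ∷ʳ y)) (q ∷ʳ y) → x ≤ suc (asc (q ∷ʳ y))) →
                   ∀ p y post → s ≡ p ++ y ∷ post → Bounded (asc (p ∷ʳ y)) (p ∷ʳ y)
bounded-prefixes starts0 ascent =
  prefix-induction (λ p → Bounded (asc p) p) starts0 bounded-[0]
    (λ q y x post s≡ bounded → bounded-∷ʳ q bounded (ascent q y x post s≡ bounded))

ascent-prefix-bounded : ∀ {s} → IsAsc s → ∀ p y post → s ≡ p ++ y ∷ post →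
                        Bounded (asc (p ∷ʳ y)) (p ∷ʳ y)
ascent-prefix-bounded (starts0 , ascent) =
  bounded-prefixes starts0 (λ q y x post s≡ _ → ascent q y x post s≡)

rgf-ascent-step : ∀ {s} → IsRGF s → ∀ q y x post → s ≡ q ++ y ∷ x ∷ post →
                  Bounded (asc (q ∷ʳ y)) (q ∷ʳ y) → x ≤ suc (asc (q ∷ʳ y))
rgf-ascent-step _                 q y zero    post _  _       = z≤n
rgf-ascent-step (_ , predecessor) q y (suc j) post s≡ bounded =
  s≤s (bounded (predecessor (q ∷ʳ y) j post (trans s≡ (sym (∷ʳ-++ q y (suc j ∷ post))))))

rgf⇒asc : ∀ s → IsRGF s → IsAsc s
rgf⇒asc s rgf@(starts0 , _) = starts0 , λ q y x post s≡ →
  rgf-ascent-step rgf q y x post s≡ (bounded-prefixes starts0 (rgf-ascent-step rgf) q y (x ∷ post) s≡)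

rasc-prefix-exhausts : ∀ {s} → IsRAsc s → ∀ p y post → s ≡ p ++ y ∷ post →
                       Exhausts (asc (p ∷ʳ y)) (p ∷ʳ y)
rasc-prefix-exhausts (isAsc@(starts0 , _) , restricted) =
  prefix-induction (λ p → Exhausts (asc p) p) starts0 exhausts-[0]
    (λ q y x post s≡ exhausts →
      exhausts-∷ʳ q (ascent-prefix-bounded isAsc q y (x ∷ post) s≡) exhausts (restricted q y x post s≡))

rasc-predecessor : ∀ {s} → IsRAsc s → ∀ q y j post → s ≡ q ++ y ∷ suc j ∷ post → j ∈ q ∷ʳ y
rasc-predecessor rasc@(isAsc , restricted) q y j post s≡ = predecessor (restricted q y (suc j) post s≡)
  where
  exhausts : Exhausts (asc (q ∷ʳ y)) (q ∷ʳ y)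
  exhausts = rasc-prefix-exhausts rasc q y (suc j ∷ post) s≡

  y≤asc : y ≤ asc (q ∷ʳ y)
  y≤asc = ascent-prefix-bounded isAsc q y (suc j ∷ post) s≡ (∈-++⁺ʳ q (here refl))

  predecessor : suc j ≤ y ⊎ suc j ≡ suc (asc (q ∷ʳ y)) → j ∈ q ∷ʳ y
  predecessor (inj₁ j+1≤y)     = exhausts (≤-trans (n≤1+n j) (≤-trans j+1≤y y≤asc))
  predecessor (inj₂ j+1≡asc+1) = exhausts (≤-reflexive (suc-injective j+1≡asc+1))

rasc⇒rgf : ∀ s → IsRAsc s → IsRGF s
rasc⇒rgf s rasc@((starts0 , _) , _) = starts0 , λ pre j post → predecessor (reverseView pre) j post
  where
  predecessor : ∀ {pre} → Reverse pre → ∀ j post → s ≡ pre ++ suc j ∷ post → j ∈ pre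
  predecessor [] j post s≡ with trans (sym (proj₂ starts0)) s≡
  ... | ()
  predecessor (q ∶ _ ∶ʳ y) j post s≡ =
    rasc-predecessor rasc q y j post (trans s≡ (∷ʳ-++ q y (suc j ∷ post)))

rgf-0101 : IsRGF (0 ∷ 1 ∷ 0 ∷ 1 ∷ [])
rgf-0101 = (_ , refl) , predecessor
  where
  predecessor : ∀ pre j post → 0 ∷ 1 ∷ 0 ∷ 1 ∷ [] ≡ pre ++ suc j ∷ post → j ∈ pre
  predecessor (_ ∷ [])                _ _ refl = here refl
  predecessor (_ ∷ _ ∷ _ ∷ [])        _ _ refl = here refl
  predecessor []                      _ _ ()
  predecessor (_ ∷ _ ∷ [])            _ _ ()
  predecessor (_ ∷ _ ∷ _ ∷ _ ∷ [])    _ _ ()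
  predecessor (_ ∷ _ ∷ _ ∷ _ ∷ _ ∷ _) _ _ ()

¬rasc-0101 : ¬ IsRAsc (0 ∷ 1 ∷ 0 ∷ 1 ∷ [])
¬rasc-0101 (_ , restricted) with restricted (0 ∷ 1 ∷ []) 0 1 [] refl
... | inj₁ ()
... | inj₂ ()

asc-01013 : IsAsc (0 ∷ 1 ∷ 0 ∷ 1 ∷ 3 ∷ [])
asc-01013 = (_ , refl) , bound
  where
  bound : ∀ pre y x post → 0 ∷ 1 ∷ 0 ∷ 1 ∷ 3 ∷ [] ≡ pre ++ y ∷ x ∷ post → x ≤ suc (asc (pre ∷ʳ y))
  bound []                          _ _ _ refl = ≤-refl
  bound (_ ∷ [])                    _ _ _ refl = z≤n
  bound (_ ∷ _ ∷ [])                _ _ _ refl = n≤1+n 1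
  bound (_ ∷ _ ∷ _ ∷ [])            _ _ _ refl = ≤-refl
  bound (_ ∷ _ ∷ _ ∷ _ ∷ [])        _ _ _ ()
  bound (_ ∷ _ ∷ _ ∷ _ ∷ _ ∷ [])    _ _ _ ()
  bound (_ ∷ _ ∷ _ ∷ _ ∷ _ ∷ _ ∷ _) _ _ _ ()

¬rgf-01013 : ¬ IsRGF (0 ∷ 1 ∷ 0 ∷ 1 ∷ 3 ∷ [])
¬rgf-01013 (_ , predecessor) with predecessor (0 ∷ 1 ∷ 0 ∷ 1 ∷ []) 2 [] refl
... | here ()
... | there (here ())
... | there (there (here ()))
... | there (there (there (here ())))

lemma4p10 : ((s : List ℕ) → IsRAsc s → IsRGF s)
    × ((s : List ℕ) → IsRGF s → IsAsc s)
    × (∃ λ (s : List ℕ) → IsRGF s × ¬ IsRAsc s)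
    × (∃ λ (s : List ℕ) → IsAsc s × ¬ IsRGF s)
lemma4p10 = rasc⇒rgf
          , rgf⇒asc
          , (_ , rgf-0101 , ¬rasc-0101)
          , (_ , asc-01013 , ¬rgf-01013)
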